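{- Let $\phi$ be a 3-CNF formula satisfying the assumptions below, and let $\mathcal S(\phi)$ and $\mathcal Z(\phi)$ be as constructed below. Then $\phi$ is satisfiable if and only if $\mathcal S(\phi)$ has a maximal common subsequence that is not contained in $\mathcal Z(\phi)$.
   Context: $\phi=C_1\wedge\dots\wedge C_m$ is on variables $x_1,\dots,x_v$; each clause is $C_i=\ell^{(i)}_1\vee\ell^{(i)}_2\vee\ell^{(i)}_3$ with $\ell^{(i)}_1\in\{x_\alpha,\bar x_\alpha\}$, $\ell^{(i)}_2\in\{x_\beta,\bar x_\beta\}$, $\ell^{(i)}_3\in\{x_\gamma,\bar x_\gamma\}$ for some $1\le\alpha<\beta<\gamma\le v$; no clause contains both $x_j$ and $\bar x_j$, and no variable appears in every clause. The alphabet is $\{x_1,\bar x_1,\dots,x_v,\bar x_v\}$. Let $R=x_v\bar x_v\cdots x_1\bar x_1$ and $X^t$ denote $X$ repeated $t$ times. $\mathcal S(\phi)=\{S_0,\dots,S_m\}$ with $S_0=x_1\bar x_1\cdots x_v\bar x_v$ and $S_i=R^{\alpha-1}\ell^{(i)}_1R^{\beta-\alpha}\ell^{(i)}_2R^{\gamma-\beta}\ell^{(i)}_3R^{v-\gamma}$. $\mathcal Z(\phi)=\{Z_1,\dots,Z_v\}$ where $Z_i$ is obtained from $S_0$ by deleting $x_i\bar x_i$. A string $Y$ is a subsequence of $X$ if obtained from $X$ by deleting characters; a maximal common subsequence of a set of strings is a common subsequence not a proper subsequence of any other common subsequence. -}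

module Defs where

open import Data.Nat using (ℕ; zero; suc; _∸_; _≤_; _<_; _≟_)
open import Data.Bool using (Bool; true; false; not; if_then_else_)
open import Data.List using (List; []; _∷_; _++_; concat; replicate; map; upTo)
open import Data.List.Relation.Unary.All using (All)
open import Data.List.Relation.Unary.Any using (Any)
open import Data.List.Relation.Binary.Sublist.Propositional using (_⊆_)
open import Data.Product using (Σ; ∃; _×_)
open import Relation.Binary.PropositionalEquality using (_≡_; _≢_)
open import Relation.Nullary.Decidable using (⌊_⌋)

data Lit : Set where
  pos : ℕ → Lit
  neg : ℕ → Lit

var : Lit → ℕ
var (pos j) = j
var (neg j) = j

record Clause : Set where
  constructor clause
  field
    l₁ l₂ l₃ : Lit
open Clause public

CNF : Set
CNF = List Clause

-- Well-formedness w.r.t. v variables: 1 ≤ α < β < γ ≤ v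
-- (this also rules out clauses containing both x_j and x̄_j)
WF : ℕ → Clause → Set
WF v c = (1 ≤ var (l₁ c)) × (var (l₁ c) < var (l₂ c)) × (var (l₂ c) < var (l₃ c)) × (var (l₃ c) ≤ v)

mentions : ℕ → Clause → Set
mentions j c = (var (l₁ c) ≡ j) Data.Sum.⊎ ((var (l₂ c) ≡ j) Data.Sum.⊎ (var (l₃ c) ≡ j))
  where import Data.Sum

NoVarInAllClauses : ℕ → CNF → Set
NoVarInAllClauses v φ = ∀ j → 1 ≤ j → j ≤ v → Any (λ c → mentions j c → Data.Empty.⊥) φ
  where import Data.Empty

evalLit : (ℕ → Bool) → Lit → Bool
evalLit a (pos j) = a j
evalLit a (neg j) = not (a j)

ClauseTrue : (ℕ → Bool) → Clause → Set
ClauseTrue a c = Any (λ l → evalLit a l ≡ true) (l₁ c ∷ l₂ c ∷ l₃ c ∷ [])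

Satisfiable : CNF → Set
Satisfiable φ = ∃ λ (a : ℕ → Bool) → All (ClauseTrue a) φ

Str : Set
Str = List Lit

rep : ℕ → Str → Str
rep t X = concat (replicate t X)

Rstr : ℕ → Str
Rstr zero = []
Rstr (suc n) = pos (suc n) ∷ neg (suc n) ∷ Rstr n

S₀ : ℕ → Str
S₀ zero = []
S₀ (suc n) = S₀ n ++ (pos (suc n) ∷ neg (suc n) ∷ [])

Zstr : ℕ → ℕ → Str
Zstr zero i = []
Zstr (suc n) i = Zstr n i ++ (if ⌊ suc n ≟ i ⌋ then [] else (pos (suc n) ∷ neg (suc n) ∷ []))

Sclause : ℕ → Clause → Str
Sclause v c =
  rep (var (l₁ c) ∸ 1) (Rstr v) ++ (l₁ c ∷
  rep (var (l₂ c) ∸ var (l₁ c)) (Rstr v) ++ (l₂ c ∷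
  rep (var (l₃ c) ∸ var (l₂ c)) (Rstr v) ++ (l₃ c ∷
  rep (v ∸ var (l₃ c)) (Rstr v))))

𝒮 : ℕ → CNF → List Str
𝒮 v φ = S₀ v ∷ map (Sclause v) φ

𝒵 : ℕ → List Str
𝒵 v = map (λ i → Zstr v (suc i)) (upTo v)

CommonSubseq : List Str → Str → Set
CommonSubseq Ss Y = All (λ X → Y ⊆ X) Ss

MaximalCommonSubseq : List Str → Str → Set
MaximalCommonSubseq Ss Y = CommonSubseq Ss Y × (∀ W → CommonSubseq Ss W → Y ⊆ W → Y ≡ W)

{-# OPTIONS --safe #-}
module Submission where

-- Order letters by their variable.  S₀ is ascending and R = x_v x̄_v ⋯ x_1 x̄_1 is
-- descending, so every common subsequence Y is ascending and meets each copy of R in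
-- letters of a single variable.  If a maximal Y misses x_j, it lies in Z_j, which is
-- itself common (it fits into the v − 1 copies of R inside each S_i), so Y = Z_j.
-- Otherwise Y contains all v variables.  Embedding it from left to right into
-- S_i = R^(α−1) ℓ₁ R^(β−α) ℓ₂ R^(γ−β) ℓ₃ R^(v−γ), the letters of each variable use up
-- a copy of R of their own, unless they are the single letter ℓ_t matched to ℓ_t.  As
-- S_i has only v − 1 copies of R this happens for some t, so making x_j false exactly
-- when x̄_j occurs in Y satisfies every clause.  Conversely, for a satisfying
-- assignment the word ℓ_1 ⋯ ℓ_v of true literals embeds into S₀ and, through a true
-- literal of C_i, into each S_i; a maximal common subsequence above it still contains
-- every variable, so it is no Z_j.

open import Defs
open import Data.Bool using (Bool; true; false; not; if_then_else_)
open import Data.Empty using (⊥-elim)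
open import Data.List using (List; []; _∷_; _++_; [_]; filter; length; map)
open import Data.List.Properties
  using (++-assoc; ++-identityʳ; filter-++; filter-all; filter-none; filter-accept; filter-reject)
open import Data.List.Extrema.Nat using (argmax; argmax-all; f[xs]≤f[argmax])
open import Data.List.Membership.Propositional using (_∈_; _∉_; find; lose)
open import Data.List.Membership.Propositional.Properties
  using (∈-filter⁺; ∈-filter⁻; ∈-map⁺; ∈-map⁻; ∈-upTo⁺; ∈-upTo⁻; ∈-++⁺ˡ; ∈-++⁺ʳ)
open import Data.List.Relation.Binary.Equality.Propositional using (≋⇒≡)
open import Data.List.Relation.Binary.Sublist.Propositional
  using (_⊆_; []; _∷_; _∷ʳ_; ⊆-refl; ⊆-trans; minimum)
open import Data.List.Relation.Binary.Sublist.Propositional.Properties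
  using (All-resp-⊆; Any-resp-⊆; filter-⊆; filter⁺; ++⁺; length-mono-≤; to-≋)
open import Data.List.Relation.Unary.All as All using (All; []; _∷_)
open import Data.List.Relation.Unary.All.Properties
  using (all-filter; ¬Any⇒All¬) renaming (++⁺ to All-++⁺; map⁺ to All-map⁺; map⁻ to All-map⁻)
open import Data.List.Relation.Unary.Any as Any using (Any; here; there)
open import Data.List.Relation.Unary.AllPairs using (AllPairs; []; _∷_)
import Data.List.Relation.Unary.AllPairs.Properties as AllPairs
open import Data.Nat using (ℕ; zero; suc; _+_; _∸_; _≤_; _<_; _≟_; _≤?_; z≤n; s≤s)
open import Data.Nat.Properties
  using ( ≤-refl; ≤-trans; ≤-antisym; ≤-reflexive; ≤-pred; <⇒≤; ≤⇒≯; ≤∧≢⇒<; n≤1+n; n≮n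
        ; m≤n⇒m≤1+n; m≤m+n; m+n≤o⇒m≤o; m+[n∸m]≡n; +-∸-assoc; +-identityʳ; +-suc; +-comm)
open import Data.Product using (∃; ∃₂; _×_; _,_; proj₁; proj₂)
open import Data.Sum using (_⊎_; inj₁; inj₂)
open import Function using (_∘_)
open import Function.Bundles using (_⇔_; mk⇔)
open import Relation.Binary.Definitions using (DecidableEquality)
open import Relation.Binary.PropositionalEquality
  using (_≡_; _≢_; refl; sym; trans; cong; cong₂; subst; subst₂; module ≡-Reasoning)
open import Relation.Nullary using (¬_; Dec; yes; no; does; ¬?; _×-dec_)
open import Relation.Nullary.Decidable using (⌊_⌋; dec-true; dec-false; map′)
open import Relation.Unary using (Decidable)

open ≡-Reasoning

AllPairs-resp-⊆ : ∀ {A : Set} {R : A → A → Set} {xs ys : List A} →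
                  xs ⊆ ys → AllPairs R ys → AllPairs R xs
AllPairs-resp-⊆ []             []         = []
AllPairs-resp-⊆ (_ ∷ʳ xs⊆ys)   (_ ∷ rys)  = AllPairs-resp-⊆ xs⊆ys rys
AllPairs-resp-⊆ (refl ∷ xs⊆ys) (ry ∷ rys) = All-resp-⊆ xs⊆ys ry ∷ AllPairs-resp-⊆ xs⊆ys rys

⊆-++⁻ : ∀ {A : Set} (xs : List A) {ys ws} → ws ⊆ xs ++ ys →
        ∃₂ λ ws₁ ws₂ → ws ≡ ws₁ ++ ws₂ × ws₁ ⊆ xs × ws₂ ⊆ ys
⊆-++⁻ []       ws⊆ys = [] , _ , refl , [] , ws⊆ys
⊆-++⁻ (x ∷ xs) (_ ∷ʳ ws⊆) with ws₁ , ws₂ , refl , ws₁⊆xs , ws₂⊆ys ← ⊆-++⁻ xs ws⊆ =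
  ws₁ , ws₂ , refl , x ∷ʳ ws₁⊆xs , ws₂⊆ys
⊆-++⁻ (x ∷ xs) (refl ∷ ws⊆) with ws₁ , ws₂ , refl , ws₁⊆xs , ws₂⊆ys ← ⊆-++⁻ xs ws⊆ =
  x ∷ ws₁ , ws₂ , refl , refl ∷ ws₁⊆xs , ws₂⊆ys

∸-telescope : ∀ {m n o} → m ≤ n → n ≤ o → (n ∸ m) + (o ∸ n) ≡ o ∸ m
∸-telescope {zero}              _         n≤o       = m+[n∸m]≡n n≤o
∸-telescope {suc m} {suc n} {suc o} (s≤s m≤n) (s≤s n≤o) = ∸-telescope m≤n n≤o

rep-+ : ∀ m n (X : Str) → rep (m + n) X ≡ rep m X ++ rep n X
rep-+ zero    n X = refl
rep-+ (suc m) n X = trans (cong (X ++_) (rep-+ m n X)) (sym (++-assoc X (rep m X) (rep n X)))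

rep-snoc : ∀ n (X : Str) → rep n X ++ X ≡ rep (suc n) X
rep-snoc zero    X = sym (++-identityʳ X)
rep-snoc (suc n) X = trans (++-assoc X (rep n X) X) (cong (X ++_) (rep-snoc n X))

-- Letters ordered by variable

Ascending Descending : Str → Set
Ascending  = AllPairs (λ x y → var x ≤ var y)
Descending = AllPairs (λ x y → var y ≤ var x)

Has : ℕ → Str → Set
Has j = Any (λ l → var l ≡ j)

Covers : ℕ → ℕ → Str → Set
Covers v k W = ∀ {j} → k ≤ j → j ≤ v → Has j W

Sole : Lit → Str → Set
Sole ℓ W = ℓ ∈ W × (∀ {l} → l ∈ W → var l ≡ var ℓ → l ≡ ℓ)

pair : ℕ → Str
pair j = pos j ∷ neg j ∷ []

Covers-mono : ∀ {v p q W} → p ≤ q → Covers v p W → Covers v q W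
Covers-mono p≤q cov q≤j j≤v = cov (≤-trans p≤q q≤j) j≤v

from : ℕ → Str → Str
from k = filter (λ l → k ≤? var l)

from-accept : ∀ {k x} W → k ≤ var x → from k (x ∷ W) ≡ x ∷ from k W
from-accept {k} _ = filter-accept (λ l → k ≤? var l)

from-reject : ∀ {k x} W → ¬ k ≤ var x → from k (x ∷ W) ≡ from k W
from-reject {k} _ = filter-reject (λ l → k ≤? var l)

from-from : ∀ {k m} → k ≤ m → ∀ W → from m (from k W) ≡ from m W
from-from k≤m [] = refl
from-from {k} {m} k≤m (x ∷ W) with m ≤? var x
... | yes m≤x = begin
  from m (from k (x ∷ W))  ≡⟨ cong (from m) (from-accept W (≤-trans k≤m m≤x)) ⟩
  from m (x ∷ from k W)    ≡⟨ from-accept (from k W) m≤x ⟩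
  x ∷ from m (from k W)    ≡⟨ cong (x ∷_) (from-from k≤m W) ⟩
  x ∷ from m W             ≡⟨ from-accept W m≤x ⟨
  from m (x ∷ W)           ∎
... | no m≰x = begin
  from m (from k (x ∷ W))  ≡⟨ dropHead ⟩
  from m (from k W)        ≡⟨ from-from k≤m W ⟩
  from m W                 ≡⟨ from-reject W m≰x ⟨
  from m (x ∷ W)           ∎
  where
  dropHead : from m (from k (x ∷ W)) ≡ from m (from k W)
  dropHead with k ≤? var x
  ... | yes k≤x = trans (cong (from m) (from-accept W k≤x)) (from-reject (from k W) m≰x)
  ... | no  k≰x = cong (from m) (from-reject W k≰x)

Has-from : ∀ {k j} W → k ≤ j → Has j W → Has j (from k W)
Has-from {k} W k≤j h with l , l∈W , l≡j ← find h =
  lose (∈-filter⁺ (λ l → k ≤? var l) l∈W (subst (k ≤_) (sym l≡j) k≤j)) l≡j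

Covers-from : ∀ {v k} W → Covers v k W → Covers v k (from k W)
Covers-from W cov k≤j j≤v = Has-from W k≤j (cov k≤j j≤v)

Sole-from : ∀ {k ℓ} W → Sole ℓ (from k W) → Sole ℓ W
Sole-from {k} W (ℓ∈ , sole) = ℓ∈W , λ l∈W l≡ℓ → sole (∈-filter⁺ P? l∈W (subst (k ≤_) (sym l≡ℓ) k≤ℓ)) l≡ℓ
  where
  P? = λ l → k ≤? var l
  ℓ∈W = proj₁ (∈-filter⁻ P? {xs = W} ℓ∈)
  k≤ℓ = proj₂ (∈-filter⁻ P? {xs = W} ℓ∈)

Rstr-vars : ∀ n → All (λ l → var l ≤ n) (Rstr n)
Rstr-vars zero    = []
Rstr-vars (suc n) = ≤-refl ∷ ≤-refl ∷ All.map m≤n⇒m≤1+n (Rstr-vars n)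

Rstr-descending : ∀ n → Descending (Rstr n)
Rstr-descending zero    = []
Rstr-descending (suc n) = (≤-refl ∷ below) ∷ below ∷ Rstr-descending n
  where below = All.map m≤n⇒m≤1+n (Rstr-vars n)

pair⊆Rstr : ∀ {j n} → 1 ≤ j → j ≤ n → pair j ⊆ Rstr n
pair⊆Rstr {n = zero}  (s≤s _) ()
pair⊆Rstr {j} {suc n} 1≤j j≤n with j ≟ suc n
... | yes refl = refl ∷ refl ∷ minimum _
... | no j≢n   = _ ∷ʳ _ ∷ʳ pair⊆Rstr 1≤j (≤-pred (≤∧≢⇒< j≤n j≢n))

S₀-vars : ∀ n → All (λ l → var l ≤ n) (S₀ n)
S₀-vars zero    = []
S₀-vars (suc n) = All-++⁺ (All.map m≤n⇒m≤1+n (S₀-vars n)) (≤-refl ∷ ≤-refl ∷ [])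

S₀-ascending : ∀ n → Ascending (S₀ n)
S₀-ascending zero    = []
S₀-ascending (suc n) =
  AllPairs.++⁺ (S₀-ascending n) ((≤-refl ∷ []) ∷ [] ∷ [])
    (All.map (λ l≤n → m≤n⇒m≤1+n l≤n ∷ m≤n⇒m≤1+n l≤n ∷ []) (S₀-vars n))

S₀⊆rep : ∀ v {n} → n ≤ v → S₀ n ⊆ rep n (Rstr v)
S₀⊆rep v {zero}  _   = []
S₀⊆rep v {suc n} n<v =
  subst (S₀ (suc n) ⊆_) (rep-snoc n (Rstr v)) (++⁺ (S₀⊆rep v (<⇒≤ n<v)) (pair⊆Rstr (s≤s z≤n) n<v))

-- S_i for any list of literals ℓ₁ ⋯ ℓ_r:
--   R^(var ℓ₁ − p) ℓ₁ R^(var ℓ₂ − var ℓ₁) ℓ₂ ⋯ ℓ_r R^(v − var ℓ_r).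
-- Sclause v c is clauseStr v 1 (l₁ c ∷ l₂ c ∷ l₃ c ∷ []) by definition.
clauseStr : ℕ → ℕ → List Lit → Str
clauseStr v p []       = rep (v ∸ p) (Rstr v)
clauseStr v p (ℓ ∷ ls) = rep (var ℓ ∸ p) (Rstr v) ++ (ℓ ∷ clauseStr v (var ℓ) ls)

VarsIncreasing : ℕ → ℕ → List Lit → Set
VarsIncreasing v p []       = p ≤ suc v
VarsIncreasing v p (ℓ ∷ ls) = p ≤ var ℓ × VarsIncreasing v (suc (var ℓ)) ls

WF⇒VarsIncreasing : ∀ {v} c → WF v c → VarsIncreasing v 1 (l₁ c ∷ l₂ c ∷ l₃ c ∷ [])
WF⇒VarsIncreasing _ (1≤α , α<β , β<γ , γ≤v) = 1≤α , α<β , β<γ , s≤s γ≤v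

VarsIncreasing-bound : ∀ {v p} ls → VarsIncreasing v p ls → p ≤ suc v
VarsIncreasing-bound []       p≤v         = p≤v
VarsIncreasing-bound (ℓ ∷ ls) (p≤ℓ , inc) = ≤-trans p≤ℓ (<⇒≤ (VarsIncreasing-bound ls inc))

VarsIncreasing-weaken : ∀ {v p q} ls → p ≤ q → VarsIncreasing v q ls → VarsIncreasing v p ls
VarsIncreasing-weaken []       p≤q q≤v         = ≤-trans p≤q q≤v
VarsIncreasing-weaken (ℓ ∷ ls) p≤q (q≤ℓ , inc) = ≤-trans p≤q q≤ℓ , inc

clauseStr-step : ∀ v {p ℓ ls} → p < var ℓ →
                 clauseStr v p (ℓ ∷ ls) ≡ Rstr v ++ clauseStr v (suc p) (ℓ ∷ ls)
clauseStr-step v {p} {ℓ} {ls} p<ℓ =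
  trans (cong (λ n → rep n (Rstr v) ++ rest) (+-∸-assoc 1 p<ℓ))
        (++-assoc (Rstr v) (rep (var ℓ ∸ suc p) (Rstr v)) rest)
  where rest = ℓ ∷ clauseStr v (var ℓ) ls

rep⊆clauseStr : ∀ v {p} ls → VarsIncreasing v p ls → rep (v ∸ p) (Rstr v) ⊆ clauseStr v p ls
rep⊆clauseStr v []       _           = ⊆-refl
rep⊆clauseStr v {p} (ℓ ∷ ls) (p≤ℓ , inc) =
  subst (_⊆ clauseStr v p (ℓ ∷ ls)) split
    (++⁺ ⊆-refl (ℓ ∷ʳ rep⊆clauseStr v ls (VarsIncreasing-weaken ls (n≤1+n _) inc)))
  where
  ℓ≤v = ≤-pred (VarsIncreasing-bound ls inc)
  split : rep (var ℓ ∸ p) (Rstr v) ++ rep (v ∸ var ℓ) (Rstr v) ≡ rep (v ∸ p) (Rstr v)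
  split = trans (sym (rep-+ (var ℓ ∸ p) (v ∸ var ℓ) (Rstr v)))
                (cong (λ n → rep n (Rstr v)) (∸-telescope p≤ℓ ℓ≤v))

-- Embedding a word that covers all variables into S_i

-- V₁ is both ascending and descending, hence on one variable.
descending-prefix-≤ : ∀ {k} V₁ {V₂} → Ascending (V₁ ++ V₂) → Descending V₁ → Has k (V₁ ++ V₂) →
                      All (λ l → var l ≤ k) V₁
descending-prefix-≤ []               _        _        _ = []
descending-prefix-≤ {k} (x ∷ V₁) {V₂} (x≤ ∷ _) (≤x ∷ _) h =
  x≤k h ∷ All.map (λ y≤x → ≤-trans y≤x (x≤k h)) ≤x
  where
  x≤k : Has k (x ∷ V₁ ++ V₂) → var x ≤ k
  x≤k (here x≡k) = ≤-reflexive x≡k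
  x≤k (there h′) with y , y∈ , y≡k ← find h′ = subst (var x ≤_) y≡k (All.lookup x≤ y∈)

dropBlock : ∀ v {k W T} → Ascending W → Has k W → from k W ⊆ Rstr v ++ T → from (suc k) W ⊆ T
dropBlock v {k} {W} {T} asc h sub with V₁ , V₂ , split , V₁⊆R , V₂⊆T ← ⊆-++⁻ (Rstr v) sub =
  subst (_⊆ T) (sym tail) (⊆-trans (filter-⊆ _ V₂) V₂⊆T)
  where
  below : All (λ l → var l ≤ k) V₁
  below = descending-prefix-≤ V₁ (subst Ascending split (AllPairs.filter⁺ _ asc))
            (AllPairs-resp-⊆ V₁⊆R (Rstr-descending v)) (subst (Has k) split (Has-from W ≤-refl h))
  tail : from (suc k) W ≡ from (suc k) V₂
  tail = begin
    from (suc k) W                      ≡⟨ from-from (n≤1+n k) W ⟨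
    from (suc k) (from k W)             ≡⟨ cong (from (suc k)) split ⟩
    from (suc k) (V₁ ++ V₂)             ≡⟨ filter-++ _ V₁ V₂ ⟩
    from (suc k) V₁ ++ from (suc k) V₂  ≡⟨ cong (_++ from (suc k) V₂) (filter-none _ (All.map ≤⇒≯ below)) ⟩
    from (suc k) V₂                     ∎

skipBlocks : ∀ v {k W T} n → Ascending W → Covers v k W → k + n ≤ suc v →
             from k W ⊆ rep n (Rstr v) ++ T → from (k + n) W ⊆ T
skipBlocks v {k} {W} {T} zero _ _ _ sub = subst (λ m → from m W ⊆ T) (sym (+-identityʳ k)) sub
skipBlocks v {k} {W} {T} (suc n) asc cov bound sub =
  subst (λ m → from m W ⊆ T) (sym (+-suc k n))
    (skipBlocks v n asc (Covers-mono (n≤1+n k) cov) k+1+n≤v (dropBlock v asc (cov ≤-refl k≤v) sub′))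
  where
  k+1+n≤v : suc k + n ≤ suc v
  k+1+n≤v = subst (_≤ suc v) (+-suc k n) bound
  k≤v : k ≤ v
  k≤v = m+n≤o⇒m≤o k (≤-pred k+1+n≤v)
  sub′ : from k W ⊆ Rstr v ++ (rep n (Rstr v) ++ T)
  sub′ = subst (from k W ⊆_) (++-assoc (Rstr v) (rep n (Rstr v)) T) sub

tooFewBlocks : ∀ v {k W} n → Ascending W → Covers v k W → k + n ≤ v → ¬ (from k W ⊆ rep n (Rstr v))
tooFewBlocks v {k} {W} n asc cov k+n≤v sub
  with Any-resp-⊆ nothingLeft (Has-from W ≤-refl (cov (m≤m+n k n) k+n≤v))
  where
  nothingLeft : from (k + n) W ⊆ []
  nothingLeft = skipBlocks v n asc cov (m≤n⇒m≤1+n k+n≤v)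
                  (subst (from k W ⊆_) (sym (++-identityʳ _)) sub)
... | ()

-- The alternative to ℓ being the only letter of W on its variable k: a word that agrees
-- with W above k and still covers k embeds into U, the part of the target after ℓ.
Overflow : ℕ → ℕ → Str → Str → Set
Overflow v k W U = ∃ λ V → V ⊆ U × Ascending V × Covers v k V × from (suc k) V ≡ from (suc k) W

literalStep : ∀ v {ℓ V U} → Ascending V → Covers v (var ℓ) V → V ⊆ ℓ ∷ U →
              Sole ℓ V ⊎ Overflow v (var ℓ) V U
literalStep v asc cov (_ ∷ʳ V⊆U) = inj₂ (_ , V⊆U , asc , cov , refl)
literalStep v {ℓ} {V = _ ∷ V} (_ ∷ asc) cov (refl ∷ V⊆U) with Any.any? (λ l → var l ≟ var ℓ) V
... | yes h  = inj₂ (V , V⊆U , asc , coversTail , sym (from-reject {x = ℓ} V (n≮n (var ℓ))))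
  where
  coversTail : Covers v (var ℓ) V
  coversTail {j} ℓ≤j j≤v with j ≟ var ℓ | cov ℓ≤j j≤v
  ... | yes refl | _        = h
  ... | no j≢ℓ   | here ℓ≡j = ⊥-elim (j≢ℓ (sym ℓ≡j))
  ... | no _     | there h′ = h′
... | no  ¬h = inj₁ (here refl , λ { (here refl) _     → refl
                                   ; (there l∈V) l≡ℓ → ⊥-elim (¬h (lose l∈V l≡ℓ)) })

atLiteral : ∀ v {p W} ℓ ls → Ascending W → Covers v p W → VarsIncreasing v p (ℓ ∷ ls) →
            from p W ⊆ clauseStr v p (ℓ ∷ ls) →
            Sole ℓ W ⊎ Overflow v (var ℓ) W (clauseStr v (var ℓ) ls)
atLiteral v {p} {W} ℓ ls asc cov (p≤ℓ , inc) sub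
  with literalStep v (AllPairs.filter⁺ _ asc) (Covers-from W (Covers-mono p≤ℓ cov)) reached
  where
  reached : from (var ℓ) W ⊆ ℓ ∷ clauseStr v (var ℓ) ls
  reached = subst (λ m → from m W ⊆ ℓ ∷ clauseStr v (var ℓ) ls) (m+[n∸m]≡n p≤ℓ)
              (skipBlocks v (var ℓ ∸ p) asc cov
                 (subst (_≤ suc v) (sym (m+[n∸m]≡n p≤ℓ)) (<⇒≤ (VarsIncreasing-bound ls inc))) sub)
... | inj₁ sole = inj₁ (Sole-from W sole)
... | inj₂ (V , V⊆ , ascV , covV , agree) =
  inj₂ (V , V⊆ , ascV , covV , trans agree (from-from (n≤1+n _) W))

soleLiteral : ∀ v {p W} ℓ ls → Ascending W → Covers v p W → VarsIncreasing v p (ℓ ∷ ls) →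
              from p W ⊆ clauseStr v p (ℓ ∷ ls) → Any (λ l → Sole l W) (ℓ ∷ ls)
soleLiteral v ℓ [] asc cov inc sub with atLiteral v ℓ [] asc cov inc sub
... | inj₁ sole = here sole
... | inj₂ (V , V⊆ , ascV , covV , _) =
  ⊥-elim (tooFewBlocks v (v ∸ var ℓ) ascV covV (≤-reflexive (m+[n∸m]≡n ℓ≤v))
            (⊆-trans (filter-⊆ _ V) V⊆))
  where ℓ≤v = ≤-pred (proj₂ inc)
soleLiteral v {p} {W} ℓ (ℓ′ ∷ ls) asc cov inc@(p≤ℓ , inc′@(ℓ<ℓ′ , _)) sub
  with atLiteral v ℓ (ℓ′ ∷ ls) asc cov inc sub
... | inj₁ sole = here sole
... | inj₂ (V , V⊆ , ascV , covV , agree) =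
  there (soleLiteral v ℓ′ ls asc (Covers-mono (≤-trans p≤ℓ (n≤1+n _)) cov) inc′ next)
  where
  ℓ≤v = ≤-pred (VarsIncreasing-bound (ℓ′ ∷ ls) inc′)
  V⊆R++ : from (var ℓ) V ⊆ Rstr v ++ clauseStr v (suc (var ℓ)) (ℓ′ ∷ ls)
  V⊆R++ = ⊆-trans (filter-⊆ _ V) (subst (V ⊆_) (clauseStr-step v {ls = ls} ℓ<ℓ′) V⊆)
  next : from (suc (var ℓ)) W ⊆ clauseStr v (suc (var ℓ)) (ℓ′ ∷ ls)
  next = subst (_⊆ clauseStr v (suc (var ℓ)) (ℓ′ ∷ ls)) agree (dropBlock v ascV (covV ≤-refl ℓ≤v) V⊆R++)

Zstr-filter : ∀ n j → Zstr n j ≡ filter (λ l → ¬? (var l ≟ j)) (S₀ n)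
Zstr-filter zero    j = refl
Zstr-filter (suc n) j =
  trans (cong₂ _++_ (Zstr-filter n j) (pair-filter (suc n))) (sym (filter-++ P? (S₀ n) (pair (suc n))))
  where
  P? = λ l → ¬? (var l ≟ j)
  pair-filter : ∀ m → (if ⌊ m ≟ j ⌋ then [] else pair m) ≡ filter P? (pair m)
  pair-filter m with m ≟ j
  ... | yes m≡j = sym (filter-none P? {xs = pair m} ((λ m≢j → m≢j m≡j) ∷ (λ m≢j → m≢j m≡j) ∷ []))
  ... | no  m≢j = sym (filter-all P? {xs = pair m} (m≢j ∷ m≢j ∷ []))

Zstr⊆S₀ : ∀ n j → Zstr n j ⊆ S₀ n
Zstr⊆S₀ n j = subst (_⊆ S₀ n) (sym (Zstr-filter n j)) (filter-⊆ _ (S₀ n))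

Zstr-lacks : ∀ n j → ¬ Has j (Zstr n j)
Zstr-lacks n j h with l , l∈ , l≡j ← find (subst (Has j) (Zstr-filter n j) h) =
  proj₂ (∈-filter⁻ (λ l → ¬? (var l ≟ j)) {xs = S₀ n} l∈) l≡j

⊆Zstr : ∀ {n j W} → W ⊆ S₀ n → ¬ Has j W → W ⊆ Zstr n j
⊆Zstr {n} {j} {W} W⊆S₀ ¬h =
  subst₂ _⊆_ (filter-all P? (¬Any⇒All¬ W ¬h)) (sym (Zstr-filter n j))
    (filter⁺ P? P? (λ { refl → λ x → x }) W⊆S₀)
  where P? = λ l → ¬? (var l ≟ j)

Zstr⊆rep : ∀ v {n j} → 1 ≤ j → j ≤ suc n → suc n ≤ v → Zstr (suc n) j ⊆ rep n (Rstr v)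
Zstr⊆rep v {zero} 1≤j j≤1 _ with refl ← ≤-antisym j≤1 1≤j = []
Zstr⊆rep v {suc n} {j} 1≤j j≤n+2 n+2≤v = lastPair (suc (suc n) ≟ j)
  where
  lastPair : (d : Dec (suc (suc n) ≡ j)) →
             Zstr (suc n) j ++ (if ⌊ d ⌋ then [] else pair (suc (suc n))) ⊆ rep (suc n) (Rstr v)
  lastPair (yes refl) =
    subst (_⊆ rep (suc n) (Rstr v)) (sym (++-identityʳ _))
      (⊆-trans (Zstr⊆S₀ (suc n) j) (S₀⊆rep v (<⇒≤ n+2≤v)))
  lastPair (no n+2≢j) =
    subst (_ ⊆_) (rep-snoc n (Rstr v))
      (++⁺ (Zstr⊆rep v 1≤j (≤-pred (≤∧≢⇒< j≤n+2 (n+2≢j ∘ sym))) (<⇒≤ n+2≤v))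
           (pair⊆Rstr (s≤s z≤n) n+2≤v))

Zstr-common : ∀ v φ {j} → All (WF v) φ → 1 ≤ j → j ≤ v → CommonSubseq (𝒮 v φ) (Zstr v j)
Zstr-common zero    φ _  (s≤s _) ()
Zstr-common (suc n) φ wf 1≤j j≤v = Zstr⊆S₀ (suc n) _ ∷ All-map⁺ (All.map Zⱼ⊆Sᵢ wf)
  where
  Zⱼ⊆Sᵢ : ∀ {c} → WF (suc n) c → Zstr (suc n) _ ⊆ Sclause (suc n) c
  Zⱼ⊆Sᵢ {c} wfc = ⊆-trans (Zstr⊆rep (suc n) 1≤j j≤v ≤-refl)
                     (rep⊆clauseStr (suc n) (l₁ c ∷ l₂ c ∷ l₃ c ∷ []) (WF⇒VarsIncreasing c wfc))

Zstr∈𝒵 : ∀ v {j} → 1 ≤ j → j ≤ v → Zstr v j ∈ 𝒵 v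
Zstr∈𝒵 v {suc i} _ j≤v = ∈-map⁺ (λ i → Zstr v (suc i)) (∈-upTo⁺ j≤v)

Covers⇒∉𝒵 : ∀ v {M} → Covers v 1 M → M ∉ 𝒵 v
Covers⇒∉𝒵 v cov M∈𝒵 with i , i∈ , refl ← ∈-map⁻ (λ i → Zstr v (suc i)) M∈𝒵 =
  Zstr-lacks v (suc i) (cov (s≤s z≤n) (∈-upTo⁻ i∈))

-- The word of an assignment

lit : (ℕ → Bool) → ℕ → Lit
lit a j = if a j then pos j else neg j

lits : (ℕ → Bool) → ℕ → ℕ → Str
lits a p zero    = []
lits a p (suc n) = lit a p ∷ lits a (suc p) n

var-lit : ∀ a j → var (lit a j) ≡ j
var-lit a j with a j
... | true  = refl
... | false = refl

lit⊆pair : ∀ a j → [ lit a j ] ⊆ pair j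
lit⊆pair a j with a j
... | true  = refl ∷ _ ∷ʳ []
... | false = _ ∷ʳ refl ∷ []

lit-true : ∀ a ℓ → evalLit a ℓ ≡ true → lit a (var ℓ) ≡ ℓ
lit-true a (pos j) t with a j | t
... | true  | _ = refl
... | false | ()
lit-true a (neg j) t with a j | t
... | false | _ = refl
... | true  | ()

lits-++ : ∀ a p m n → lits a p (m + n) ≡ lits a p m ++ lits a (p + m) n
lits-++ a p zero    n = cong (λ q → lits a q n) (sym (+-identityʳ p))
lits-++ a p (suc m) n = cong (lit a p ∷_) (begin
  lits a (suc p) (m + n)                   ≡⟨ lits-++ a (suc p) m n ⟩
  lits a (suc p) m ++ lits a (suc p + m) n ≡⟨ cong (λ q → lits a (suc p) m ++ lits a q n) (+-suc p m) ⟨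
  lits a (suc p) m ++ lits a (p + suc m) n ∎)

lits⊆rep : ∀ v a {p} n → 1 ≤ p → p + n ≤ suc v → lits a p n ⊆ rep n (Rstr v)
lits⊆rep v a     zero    _   _     = []
lits⊆rep v a {p} (suc n) 1≤p p+n≤v = ++⁺ lit⊆R (lits⊆rep v a n (s≤s z≤n) p+1+n≤v)
  where
  p+1+n≤v : suc p + n ≤ suc v
  p+1+n≤v = subst (_≤ suc v) (+-suc p n) p+n≤v
  lit⊆R : [ lit a p ] ⊆ Rstr v
  lit⊆R = ⊆-trans (lit⊆pair a p) (pair⊆Rstr 1≤p (m+n≤o⇒m≤o p (≤-pred p+1+n≤v)))

lits⊆S₀ : ∀ a n → lits a 1 n ⊆ S₀ n
lits⊆S₀ a zero    = []
lits⊆S₀ a (suc n) =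
  subst (_⊆ S₀ (suc n)) (trans (sym (lits-++ a 1 n 1)) (cong (lits a 1) (+-comm n 1)))
    (++⁺ (lits⊆S₀ a n) (lit⊆pair a (suc n)))

Has-lits : ∀ a {p j} n → p ≤ j → j < p + n → Has j (lits a p n)
Has-lits a {p} {j} zero    p≤j j<p   = ⊥-elim (≤⇒≯ p≤j (subst (j <_) (+-identityʳ p) j<p))
Has-lits a {p} {j} (suc n) p≤j j<p+n with p ≟ j
... | yes refl = here (var-lit a p)
... | no  p≢j  = there (Has-lits a n (≤∧≢⇒< p≤j p≢j) (subst (j <_) (+-suc p n) j<p+n))

lits⊆clauseStr : ∀ v a {p} ls → 1 ≤ p → VarsIncreasing v p ls → Any (λ ℓ → evalLit a ℓ ≡ true) ls →
                 lits a p (suc v ∸ p) ⊆ clauseStr v p ls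
lits⊆clauseStr v a {p} (ℓ ∷ ls) 1≤p (p≤ℓ , inc) sat =
  subst (_⊆ clauseStr v p (ℓ ∷ ls)) (sym split)
    (++⁺ (lits⊆rep v a (var ℓ ∸ p) 1≤p (subst (_≤ suc v) (sym (m+[n∸m]≡n p≤ℓ)) (<⇒≤ ℓ<v+1))) (atℓ sat))
  where
  ℓ<v+1 = VarsIncreasing-bound ls inc
  ℓ≤v   = ≤-pred ℓ<v+1
  k     = var ℓ
  split : lits a p (suc v ∸ p) ≡ lits a p (k ∸ p) ++ lits a k (suc v ∸ k)
  split = begin
    lits a p (suc v ∸ p)
      ≡⟨ cong (lits a p) (∸-telescope p≤ℓ (<⇒≤ ℓ<v+1)) ⟨
    lits a p ((k ∸ p) + (suc v ∸ k))
      ≡⟨ lits-++ a p (k ∸ p) (suc v ∸ k) ⟩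
    lits a p (k ∸ p) ++ lits a (p + (k ∸ p)) (suc v ∸ k)
      ≡⟨ cong (λ q → lits a p (k ∸ p) ++ lits a q (suc v ∸ k)) (m+[n∸m]≡n p≤ℓ) ⟩
    lits a p (k ∸ p) ++ lits a k (suc v ∸ k)
      ∎
  atℓ : Any (λ ℓ → evalLit a ℓ ≡ true) (ℓ ∷ ls) → lits a k (suc v ∸ k) ⊆ ℓ ∷ clauseStr v k ls
  atℓ (here t) =
    subst (_⊆ ℓ ∷ clauseStr v k ls) (cong (lits a k) (sym (+-∸-assoc 1 ℓ≤v)))
      (lit-true a ℓ t ∷ ⊆-trans (lits⊆rep v a (v ∸ k) (s≤s z≤n) (s≤s (≤-reflexive (m+[n∸m]≡n ℓ≤v))))
                                (rep⊆clauseStr v ls (VarsIncreasing-weaken ls (n≤1+n _) inc)))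
  atℓ (there sat′) =
    ℓ ∷ʳ lits⊆clauseStr v a ls (≤-trans 1≤p p≤ℓ) (VarsIncreasing-weaken ls (n≤1+n _) inc) sat′

_≟ˡ_ : DecidableEquality Lit
pos i ≟ˡ pos j = map′ (cong pos) (λ { refl → refl }) (i ≟ j)
pos _ ≟ˡ neg _ = no λ ()
neg _ ≟ˡ pos _ = no λ ()
neg i ≟ˡ neg j = map′ (cong neg) (λ { refl → refl }) (i ≟ j)

open import Data.List.Membership.DecPropositional _≟ˡ_ using (_∈?_)
open import Data.List.Relation.Binary.Sublist.DecPropositional _≟ˡ_ using (_⊆?_)

sublists : ∀ {A : Set} → List A → List (List A)
sublists []       = [ [] ]
sublists (x ∷ xs) = map (x ∷_) (sublists xs) ++ sublists xs

∈-sublists : ∀ {A : Set} {xs ys : List A} → ys ⊆ xs → ys ∈ sublists xs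
∈-sublists []                         = here refl
∈-sublists {xs = x ∷ xs} (_ ∷ʳ ys⊆xs) = ∈-++⁺ʳ (map (x ∷_) (sublists xs)) (∈-sublists ys⊆xs)
∈-sublists (refl ∷ ys⊆xs)             = ∈-++⁺ˡ (∈-map⁺ (_ ∷_) (∈-sublists ys⊆xs))

-- A longest common subsequence among the sublists of X that contain Y is maximal.
extendToMaximal : ∀ X Ss {Y} → CommonSubseq (X ∷ Ss) Y →
                  ∃ λ M → MaximalCommonSubseq (X ∷ Ss) M × Y ⊆ M
extendToMaximal X Ss {Y} common = M , (proj₂ M-candidate , maximal) , proj₁ M-candidate
  where
  Candidate : Str → Set
  Candidate W = Y ⊆ W × CommonSubseq (X ∷ Ss) W
  candidate? : Decidable Candidate
  candidate? W = (Y ⊆? W) ×-dec All.all? (W ⊆?_) (X ∷ Ss)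
  candidates = filter candidate? (sublists X)
  M = argmax length Y candidates
  M-candidate : Candidate M
  M-candidate = argmax-all length (⊆-refl , common) (all-filter candidate? (sublists X))
  maximal : ∀ W → CommonSubseq (X ∷ Ss) W → M ⊆ W → M ≡ W
  maximal W common-W M⊆W = ≋⇒≡ (to-≋ (≤-antisym (length-mono-≤ M⊆W) W≤M) M⊆W)
    where
    W∈ = ∈-filter⁺ candidate? (∈-sublists (All.head common-W))
           (⊆-trans (proj₁ M-candidate) M⊆W , common-W)
    W≤M = All.lookup (f[xs]≤f[argmax] {f = length} Y candidates) W∈

maximal-above-covering : ∀ v φ {Y} → CommonSubseq (𝒮 v φ) Y → Covers v 1 Y →
                         ∃ λ M → MaximalCommonSubseq (𝒮 v φ) M × M ∉ 𝒵 v
maximal-above-covering v φ common cov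
  with M , maxM , Y⊆M ← extendToMaximal (S₀ v) (map (Sclause v) φ) common =
  M , maxM , Covers⇒∉𝒵 v (λ 1≤j j≤v → Any-resp-⊆ Y⊆M (cov 1≤j j≤v))

readAssignment : Str → ℕ → Bool
readAssignment Y j = not (does (neg j ∈? Y))

Sole⇒true : ∀ {Y ℓ} → Sole ℓ Y → evalLit (readAssignment Y) ℓ ≡ true
Sole⇒true {Y} {pos j} (_ , sole) =
  cong not (dec-false (neg j ∈? Y) (λ neg∈Y → neg≢pos (sole neg∈Y refl)))
  where
  neg≢pos : neg j ≢ pos j
  neg≢pos ()
Sole⇒true {Y} {neg j} (neg∈Y , _) = cong (not ∘ not) (dec-true (neg j ∈? Y) neg∈Y)

maximal-covers : ∀ v φ {Y} → All (WF v) φ → MaximalCommonSubseq (𝒮 v φ) Y → Y ∉ 𝒵 v → Covers v 1 Y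
maximal-covers v φ {Y} wf (common , maximal) Y∉𝒵 {j} 1≤j j≤v with Any.any? (λ l → var l ≟ j) Y
... | yes h  = h
... | no  ¬h = ⊥-elim (Y∉𝒵 (subst (_∈ 𝒵 v) (sym Y≡Zⱼ) (Zstr∈𝒵 v 1≤j j≤v)))
  where Y≡Zⱼ = maximal (Zstr v j) (Zstr-common v φ wf 1≤j j≤v) (⊆Zstr {n = v} (All.head common) ¬h)

satisfiable-from-maximal : ∀ v φ {Y} → All (WF v) φ → MaximalCommonSubseq (𝒮 v φ) Y → Y ∉ 𝒵 v →
                           Satisfiable φ
satisfiable-from-maximal v φ {Y} wf maxY@((Y⊆S₀ ∷ Y⊆Sᵢ) , _) Y∉𝒵 =
  readAssignment Y , All.zipWith clauseTrue (wf , All-map⁻ Y⊆Sᵢ)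
  where
  clauseTrue : ∀ {c} → WF v c × Y ⊆ Sclause v c → ClauseTrue (readAssignment Y) c
  clauseTrue {c} (wfc , Y⊆S) =
    Any.map Sole⇒true
      (soleLiteral v (l₁ c) (l₂ c ∷ l₃ c ∷ []) (AllPairs-resp-⊆ Y⊆S₀ (S₀-ascending v))
         (maximal-covers v φ wf maxY Y∉𝒵) (WF⇒VarsIncreasing c wfc) (⊆-trans (filter-⊆ _ Y) Y⊆S))

maximal-from-satisfiable : ∀ v φ → All (WF v) φ → Satisfiable φ →
                           ∃ λ Y → MaximalCommonSubseq (𝒮 v φ) Y × Y ∉ 𝒵 v
maximal-from-satisfiable v φ wf (a , sat) =
  maximal-above-covering v φ common (λ 1≤j j≤v → Has-lits a v 1≤j (s≤s j≤v))
  where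
  lits⊆Sᵢ : ∀ {c} → WF v c × ClauseTrue a c → lits a 1 v ⊆ Sclause v c
  lits⊆Sᵢ {c} (wfc , t) =
    lits⊆clauseStr v a (l₁ c ∷ l₂ c ∷ l₃ c ∷ []) (s≤s z≤n) (WF⇒VarsIncreasing c wfc) t
  common : CommonSubseq (𝒮 v φ) (lits a 1 v)
  common = lits⊆S₀ a v ∷ All-map⁺ (All.zipWith lits⊆Sᵢ (wf , sat))

lemma3 : (v : ℕ) (φ : CNF) → All (WF v) φ → NoVarInAllClauses v φ →
    Satisfiable φ ⇔ (∃ λ Y → MaximalCommonSubseq (𝒮 v φ) Y × Y ∉ 𝒵 v)
lemma3 v φ wf _ = mk⇔ (maximal-from-satisfiable v φ wf)
                      (λ { (Y , maxY , Y∉𝒵) → satisfiable-from-maximal v φ wf maxY Y∉𝒵 })
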